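{- Let $\mathcal T\in\{\mathcal T_{\rm CD},\mathcal T_{\rm CDS},\mathcal T_{\rm CDV},\mathcal T_{\rm BCD}\}$ and $\mathcal R\in\{\equiv,=_\beta,=_{\beta\eta}\}$. If $B\vdash^{\mathcal T}_{\mathcal R}\Delta:\sigma$, then $\Delta$ is strongly normalizing with respect to $\to$.
   Context: Types: $\mathbb A_\infty=\{a_i\mid i\in\mathbb N\}$, $\omega$ special atom, $\mathbb A^\omega_\infty=\mathbb A_\infty\cup\{\omega\}$; types $\sigma::=\mathbb A\mid\sigma\to\sigma\mid\sigma\cap\sigma$. Minimal type theory: (refl), (incl) $\sigma\cap\tau\le\sigma,\sigma\cap\tau\le\tau$, (glb) $\rho\le\sigma,\rho\le\tau\Rightarrow\rho\le\sigma\cap\tau$, (trans). Extras: $(\omega_{top})$ $\sigma\le\omega$; $(\omega_\to)$ $\omega\le\sigma\to\omega$; $(\to\cap)$ $(\sigma\to\tau)\cap(\sigma\to\rho)\le\sigma\to\tau\cap\rho$; $(\to)$ $\sigma_2\le\sigma_1,\tau_1\le\tau_2\Rightarrow\sigma_1\to\tau_1\le\sigma_2\to\tau_2$. $\mathcal T_{\rm CD}$: over $\mathbb A_\infty$, minimal; $\mathcal T_{\rm CDS}$: over $\mathbb A^\omega_\infty$ plus $(\omega_{top})$; $\mathcal T_{\rm CDV}$: over $\mathbb A_\infty$ plus $(\to),(\to\cap)$; $\mathcal T_{\rm BCD}$: over $\mathbb A^\omega_\infty$ plus all four extras. $\Delta$-terms: $\Delta::=u_\Delta\mid x\mid\lambda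 x{:}\sigma.\Delta\mid\Delta\,\Delta\mid\langle\Delta,\Delta\rangle\mid pr_i\Delta\mid\Delta^\sigma$, $u_\Delta$ a constant indexed by an arbitrary $\Delta$-term. Essence: $\lfloor x\rfloor=x$, $\lfloor u_\Delta\rfloor=\lfloor\Delta\rfloor$, $\lfloor\Delta^\sigma\rfloor=\lfloor\Delta\rfloor$, $\lfloor\lambda x{:}\sigma.\Delta\rfloor=\lambda x.\lfloor\Delta\rfloor$, $\lfloor\Delta_1\Delta_2\rfloor=\lfloor\Delta_1\rfloor\lfloor\Delta_2\rfloor$, $\lfloor\langle\Delta_1,\Delta_2\rangle\rfloor=\lfloor\Delta_1\rfloor$, $\lfloor pr_i\Delta\rfloor=\lfloor\Delta\rfloor$. Typed system $\Delta^{\mathcal T}_{\mathcal R}$: (top) $B\vdash u_\Delta:\omega$ if $\omega$ is an atom of $\mathcal T$; (ax) $B\vdash x:\sigma$ if $x{:}\sigma\in B$; ($\to I$) $B,x{:}\sigma\vdash\Delta:\tau\Rightarrow B\vdash\lambda x{:}\sigma.\Delta:\sigma\to\tau$; ($\to E$) from $\Delta_1:\sigma\to\tau$, $\Delta_2:\sigma$ get $\Delta_1\Delta_2:\tau$; ($\cap I$) from $B\vdash\Delta_1:\sigma$, $B\vdash\Delta_2:\tau$, $\lfloor\Delta_1\rfloor\mathcal R\lfloor\Delta_2\rfloor$ get $B\vdash\langle\Delta_1,\Delta_2\rangle:\sigma\cap\tau$; ($\cap E_i$) from $\Delta:\sigma\cap\tau$ get $pr_1\Delta:\sigma$, $pr_2\Delta:\tau$;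 ($\le_{\mathcal T}$) from $\Delta:\sigma$, $\sigma\le_{\mathcal T}\tau$ get $\Delta^\tau:\tau$. Reduction $\to$: contextual closure (no reduction inside the index of $u_\Delta$) of $(\beta)$ $(\lambda x{:}\sigma.\Delta_1)\Delta_2\to\Delta_1[\Delta_2/x]$ and $(pr_i)$ $pr_i\langle\Delta_1,\Delta_2\rangle\to\Delta_i$, with substitution propagating into indices, $u_{\Delta_1}[\Delta_2/x]=u_{(\Delta_1[\Delta_2/x])}$, and into coercions. -}

module Defs where

open import Data.Nat using (ℕ; zero; suc; _<ᵇ_; _≡ᵇ_; pred)
open import Data.Bool using (Bool; true; false; if_then_else_)
open import Data.List using (List; []; _∷_)
open import Relation.Binary.PropositionalEquality using (_≡_)
open import Relation.Binary.Construct.Closure.Equivalence using (EqClosure)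
open import Induction.WellFounded using (Acc)

data Theory : Set where
  CD CDS CDV BCD : Theory

data OmegaAtom : Theory → Set where
  ω-CDS : OmegaAtom CDS
  ω-BCD : OmegaAtom BCD

-- T contains the rules (→) and (→∩)  (T = CDV or T = BCD)
data ArrowRules : Theory → Set where
  ar-CDV : ArrowRules CDV
  ar-BCD : ArrowRules BCD

data Ty (T : Theory) : Set where
  at  : ℕ → Ty T
  ω   : OmegaAtom T → Ty T
  _⇒_ : Ty T → Ty T → Ty T
  _∩_ : Ty T → Ty T → Ty T

infixr 7 _⇒_
infixl 8 _∩_

infix 4 _⊢_≤_

data _⊢_≤_ : (T : Theory) → Ty T → Ty T → Set where
  refl  : ∀ {T σ} → T ⊢ σ ≤ σ
  incl₁ : ∀ {T σ τ} → T ⊢ σ ∩ τ ≤ σ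
  incl₂ : ∀ {T σ τ} → T ⊢ σ ∩ τ ≤ τ
  glb   : ∀ {T ρ σ τ} → T ⊢ ρ ≤ σ → T ⊢ ρ ≤ τ → T ⊢ ρ ≤ σ ∩ τ
  trans : ∀ {T σ τ ρ} → T ⊢ σ ≤ τ → T ⊢ τ ≤ ρ → T ⊢ σ ≤ ρ
  ω-top : ∀ {T σ} (o : OmegaAtom T) → T ⊢ σ ≤ ω o
  ω-→   : ∀ {σ} → BCD ⊢ ω ω-BCD ≤ (σ ⇒ ω ω-BCD)
  →∩    : ∀ {T σ τ ρ} → ArrowRules T → T ⊢ (σ ⇒ τ) ∩ (σ ⇒ ρ) ≤ σ ⇒ (τ ∩ ρ)
  arrow : ∀ {T σ₁ σ₂ τ₁ τ₂} → ArrowRules T →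
          T ⊢ σ₂ ≤ σ₁ → T ⊢ τ₁ ≤ τ₂ → T ⊢ σ₁ ⇒ τ₁ ≤ σ₂ ⇒ τ₂

data Λ : Set where
  var : ℕ → Λ
  ƛ   : Λ → Λ
  _·_ : Λ → Λ → Λ

infixl 9 _·_
infix 4 _⟶β_ _⟶βη_

shiftΛ : ℕ → Λ → Λ
shiftΛ c (var i) = if i <ᵇ c then var i else var (suc i)
shiftΛ c (ƛ M)   = ƛ (shiftΛ (suc c) M)
shiftΛ c (M · N) = shiftΛ c M · shiftΛ c N

-- M[j := N], removing the binder of index j
substΛ : ℕ → Λ → Λ → Λ
substΛ j (var i) N = if i ≡ᵇ j then N else (if j <ᵇ i then var (pred i) else var i)
substΛ j (ƛ M)   N = ƛ (substΛ (suc j) M (shiftΛ 0 N))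
substΛ j (M · M') N = substΛ j M N · substΛ j M' N

data _⟶β_ : Λ → Λ → Set where
  β    : ∀ {M N} → (ƛ M) · N ⟶β substΛ 0 M N
  ξ    : ∀ {M M'} → M ⟶β M' → ƛ M ⟶β ƛ M'
  appL : ∀ {M M' N} → M ⟶β M' → M · N ⟶β M' · N
  appR : ∀ {M N N'} → N ⟶β N' → M · N ⟶β M · N'

data _⟶βη_ : Λ → Λ → Set where
  β    : ∀ {M N} → (ƛ M) · N ⟶βη substΛ 0 M N
  η    : ∀ {M} → ƛ (shiftΛ 0 M · var 0) ⟶βη M
  ξ    : ∀ {M M'} → M ⟶βη M' → ƛ M ⟶βη ƛ M'
  appL : ∀ {M M' N} → M ⟶βη M' → M · N ⟶βη M' · N
  appR : ∀ {M N N'} → N ⟶βη N' → M · N ⟶βη M · N'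

data Rel : Set where
  syn βconv βηconv : Rel

⟦_⟧ᴿ : Rel → Λ → Λ → Set
⟦ syn ⟧ᴿ    M N = M ≡ N
⟦ βconv ⟧ᴿ  M N = EqClosure _⟶β_ M N
⟦ βηconv ⟧ᴿ M N = EqClosure _⟶βη_ M N

data Tm (T : Theory) : Set where
  u    : Tm T → Tm T
  var  : ℕ → Tm T
  lam  : Ty T → Tm T → Tm T
  app  : Tm T → Tm T → Tm T
  pair : Tm T → Tm T → Tm T
  pr₁  : Tm T → Tm T
  pr₂  : Tm T → Tm T
  coe  : Ty T → Tm T → Tm T

⌊_⌋ : ∀ {T} → Tm T → Λ
⌊ u Δ ⌋        = ⌊ Δ ⌋
⌊ var i ⌋      = var i
⌊ lam σ Δ ⌋    = ƛ ⌊ Δ ⌋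
⌊ app Δ₁ Δ₂ ⌋  = ⌊ Δ₁ ⌋ · ⌊ Δ₂ ⌋
⌊ pair Δ₁ Δ₂ ⌋ = ⌊ Δ₁ ⌋
⌊ pr₁ Δ ⌋      = ⌊ Δ ⌋
⌊ pr₂ Δ ⌋      = ⌊ Δ ⌋
⌊ coe σ Δ ⌋    = ⌊ Δ ⌋

module _ {T : Theory} where

  shift : ℕ → Tm T → Tm T
  shift c (u Δ)        = u (shift c Δ)
  shift c (var i)      = if i <ᵇ c then var i else var (suc i)
  shift c (lam σ Δ)    = lam σ (shift (suc c) Δ)
  shift c (app Δ₁ Δ₂)  = app (shift c Δ₁) (shift c Δ₂)
  shift c (pair Δ₁ Δ₂) = pair (shift c Δ₁) (shift c Δ₂)
  shift c (pr₁ Δ)      = pr₁ (shift c Δ)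
  shift c (pr₂ Δ)      = pr₂ (shift c Δ)
  shift c (coe σ Δ)    = coe σ (shift c Δ)

  subst : ℕ → Tm T → Tm T → Tm T
  subst j (u Δ)        N = u (subst j Δ N)
  subst j (var i)      N = if i ≡ᵇ j then N else (if j <ᵇ i then var (pred i) else var i)
  subst j (lam σ Δ)    N = lam σ (subst (suc j) Δ (shift 0 N))
  subst j (app Δ₁ Δ₂)  N = app (subst j Δ₁ N) (subst j Δ₂ N)
  subst j (pair Δ₁ Δ₂) N = pair (subst j Δ₁ N) (subst j Δ₂ N)
  subst j (pr₁ Δ)      N = pr₁ (subst j Δ N)
  subst j (pr₂ Δ)      N = pr₂ (subst j Δ N)
  subst j (coe σ Δ)    N = coe σ (subst j Δ N)

  infix 4 _⟶_

  -- one-step reduction: contextual closure of (β) and (pr_i),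
  -- with no reduction inside the index of u_Δ
  data _⟶_ : Tm T → Tm T → Set where
    β      : ∀ {σ Δ₁ Δ₂} → app (lam σ Δ₁) Δ₂ ⟶ subst 0 Δ₁ Δ₂
    pr₁β   : ∀ {Δ₁ Δ₂} → pr₁ (pair Δ₁ Δ₂) ⟶ Δ₁
    pr₂β   : ∀ {Δ₁ Δ₂} → pr₂ (pair Δ₁ Δ₂) ⟶ Δ₂
    ξlam   : ∀ {σ Δ Δ'} → Δ ⟶ Δ' → lam σ Δ ⟶ lam σ Δ'
    appL   : ∀ {Δ Δ' N} → Δ ⟶ Δ' → app Δ N ⟶ app Δ' N
    appR   : ∀ {M Δ Δ'} → Δ ⟶ Δ' → app M Δ ⟶ app M Δ'
    pairL  : ∀ {Δ Δ' N} → Δ ⟶ Δ' → pair Δ N ⟶ pair Δ' N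
    pairR  : ∀ {M Δ Δ'} → Δ ⟶ Δ' → pair M Δ ⟶ pair M Δ'
    ξpr₁   : ∀ {Δ Δ'} → Δ ⟶ Δ' → pr₁ Δ ⟶ pr₁ Δ'
    ξpr₂   : ∀ {Δ Δ'} → Δ ⟶ Δ' → pr₂ Δ ⟶ pr₂ Δ'
    ξcoe   : ∀ {σ Δ Δ'} → Δ ⟶ Δ' → coe σ Δ ⟶ coe σ Δ'

  SN : Tm T → Set
  SN = Acc (λ Δ' Δ → Δ ⟶ Δ')

-- Typing  B ⊢^T_R Δ : σ   (bases as lists; variable i has the i-th type)

infix 4 _∋_⦂_ _,_∣_⊢_⦂_

data _∋_⦂_ {T : Theory} : List (Ty T) → ℕ → Ty T → Set where
  here  : ∀ {B σ} → (σ ∷ B) ∋ zero ⦂ σ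
  there : ∀ {B σ τ i} → B ∋ i ⦂ σ → (τ ∷ B) ∋ suc i ⦂ σ

data _,_∣_⊢_⦂_ (T : Theory) (R : Rel) : List (Ty T) → Tm T → Ty T → Set where
  top : ∀ {B Δ} (o : OmegaAtom T) → T , R ∣ B ⊢ u Δ ⦂ ω o
  ax  : ∀ {B i σ} → B ∋ i ⦂ σ → T , R ∣ B ⊢ var i ⦂ σ
  →I  : ∀ {B σ τ Δ} → T , R ∣ (σ ∷ B) ⊢ Δ ⦂ τ → T , R ∣ B ⊢ lam σ Δ ⦂ σ ⇒ τ
  →E  : ∀ {B σ τ Δ₁ Δ₂} → T , R ∣ B ⊢ Δ₁ ⦂ σ ⇒ τ → T , R ∣ B ⊢ Δ₂ ⦂ σ →
        T , R ∣ B ⊢ app Δ₁ Δ₂ ⦂ τ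
  ∩I  : ∀ {B σ τ Δ₁ Δ₂} → T , R ∣ B ⊢ Δ₁ ⦂ σ → T , R ∣ B ⊢ Δ₂ ⦂ τ →
        ⟦ R ⟧ᴿ ⌊ Δ₁ ⌋ ⌊ Δ₂ ⌋ → T , R ∣ B ⊢ pair Δ₁ Δ₂ ⦂ σ ∩ τ
  ∩E₁ : ∀ {B σ τ Δ} → T , R ∣ B ⊢ Δ ⦂ σ ∩ τ → T , R ∣ B ⊢ pr₁ Δ ⦂ σ
  ∩E₂ : ∀ {B σ τ Δ} → T , R ∣ B ⊢ Δ ⦂ σ ∩ τ → T , R ∣ B ⊢ pr₂ Δ ⦂ τ
  ≤T  : ∀ {B σ τ Δ} → T , R ∣ B ⊢ Δ ⦂ σ → T ⊢ σ ≤ τ → T , R ∣ B ⊢ coe τ Δ ⦂ τ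

-- Tait's reducibility method. A type is interpreted as a set of strongly
-- normalising terms: atoms and ω by SN itself, σ → τ by application and σ ∩ τ by
-- the two projections, since an intersection is introduced by a pair.  The constant u_Δ has no
-- reducts at all, as reduction does not enter its index.

module Submission where

open import Data.Bool using (true; false)
open import Data.Bool.Properties using (T-≡)
open import Data.Empty using (⊥-elim)
open import Data.List using (List; _∷_)
open import Data.Nat using (ℕ; zero; suc; _<ᵇ_; _≡ᵇ_; _+_; _≤_; _<_; z≤n; s≤s)
open import Data.Nat.Properties
  using (<⇒<ᵇ; ≡⇒≡ᵇ; <⇒≢; >⇒≢; <⇒≤; <-cmp; <-≤-connex; ≤-trans; <-≤-trans;
         m≤m+n; m≤n⇒m≤1+n; m<n⇒m<1+n)
open import Data.Product using (_×_; _,_; proj₁; proj₂)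
open import Data.Sum using (inj₁; inj₂)
open import Function using (_∘_)
open import Function.Bundles using (Equivalence)
open import Induction.WellFounded using (acc)
open import Relation.Binary using (tri<; tri≈; tri>)
open import Relation.Binary.PropositionalEquality as Eq using (_≡_; _≢_; refl; sym; cong; cong₂)

open import Defs

<ᵇ-true : ∀ {m n} → m < n → (m <ᵇ n) ≡ true
<ᵇ-true = Equivalence.to T-≡ ∘ <⇒<ᵇ

<ᵇ-false : ∀ {m n} → n ≤ m → (m <ᵇ n) ≡ false
<ᵇ-false {n = zero}      _       = refl
<ᵇ-false {suc m} {suc n} (s≤s p) = <ᵇ-false p

≡ᵇ-refl : ∀ m → (m ≡ᵇ m) ≡ true
≡ᵇ-refl m = Equivalence.to T-≡ (≡⇒≡ᵇ m m refl)

≡ᵇ-false : ∀ {m n} → m ≢ n → (m ≡ᵇ n) ≡ false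
≡ᵇ-false {zero}  {zero}  m≢n = ⊥-elim (m≢n refl)
≡ᵇ-false {zero}  {suc n} _   = refl
≡ᵇ-false {suc m} {zero}  _   = refl
≡ᵇ-false {suc m} {suc n} m≢n = ≡ᵇ-false (m≢n ∘ cong suc)

module _ {T : Theory} where

  shift-var-< : ∀ {c i} → i < c → shift {T} c (var i) ≡ var i
  shift-var-< i<c rewrite <ᵇ-true i<c = refl

  shift-var-≥ : ∀ {c i} → c ≤ i → shift {T} c (var i) ≡ var (suc i)
  shift-var-≥ c≤i rewrite <ᵇ-false c≤i = refl

  subst-var-≡ : ∀ j (N : Tm T) → subst j (var j) N ≡ N
  subst-var-≡ j N rewrite ≡ᵇ-refl j = refl

  subst-var-< : ∀ {i j} → i < j → (N : Tm T) → subst j (var i) N ≡ var i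
  subst-var-< i<j N rewrite ≡ᵇ-false (<⇒≢ i<j) | <ᵇ-false (<⇒≤ i<j) = refl

  subst-var-suc : ∀ {i j} → j ≤ i → (N : Tm T) → subst j (var (suc i)) N ≡ var i
  subst-var-suc j≤i N rewrite ≡ᵇ-false (>⇒≢ (s≤s j≤i)) | <ᵇ-true (s≤s j≤i) = refl

  shift-comm : ∀ {c d} → c ≤ d → (M : Tm T) → shift (suc d) (shift c M) ≡ shift c (shift d M)
  shift-comm c≤d (u M) = cong u (shift-comm c≤d M)
  shift-comm {c} {d} c≤d (var i) with <-≤-connex i c | <-≤-connex i d
  ... | inj₁ i<c | _ rewrite shift-var-< i<c | shift-var-< (<-≤-trans i<c c≤d)
                           | shift-var-< (m<n⇒m<1+n (<-≤-trans i<c c≤d)) | shift-var-< i<c = refl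
  ... | inj₂ c≤i | inj₁ i<d rewrite shift-var-≥ c≤i | shift-var-< i<d
                                  | shift-var-< (s≤s i<d) | shift-var-≥ c≤i = refl
  ... | inj₂ c≤i | inj₂ d≤i rewrite shift-var-≥ c≤i | shift-var-≥ d≤i
                                  | shift-var-≥ (s≤s d≤i) | shift-var-≥ (m≤n⇒m≤1+n c≤i) = refl
  shift-comm c≤d (lam σ M)  = cong (lam σ) (shift-comm (s≤s c≤d) M)
  shift-comm c≤d (app M N)  = cong₂ app (shift-comm c≤d M) (shift-comm c≤d N)
  shift-comm c≤d (pair M N) = cong₂ pair (shift-comm c≤d M) (shift-comm c≤d N)
  shift-comm c≤d (pr₁ M)    = cong pr₁ (shift-comm c≤d M)
  shift-comm c≤d (pr₂ M)    = cong pr₂ (shift-comm c≤d M)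
  shift-comm c≤d (coe σ M)  = cong (coe σ) (shift-comm c≤d M)

  subst-shift-cancel : ∀ c (M N : Tm T) → subst c (shift c M) N ≡ M
  subst-shift-cancel c (u M) N = cong u (subst-shift-cancel c M N)
  subst-shift-cancel c (var i) N with <-≤-connex i c
  ... | inj₁ i<c rewrite shift-var-< i<c | subst-var-< i<c N = refl
  ... | inj₂ c≤i rewrite shift-var-≥ c≤i | subst-var-suc c≤i N = refl
  subst-shift-cancel c (lam σ M)  N = cong (lam σ) (subst-shift-cancel (suc c) M (shift 0 N))
  subst-shift-cancel c (app M M') N = cong₂ app (subst-shift-cancel c M N) (subst-shift-cancel c M' N)
  subst-shift-cancel c (pair M M') N = cong₂ pair (subst-shift-cancel c M N) (subst-shift-cancel c M' N)
  subst-shift-cancel c (pr₁ M)    N = cong pr₁ (subst-shift-cancel c M N)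
  subst-shift-cancel c (pr₂ M)    N = cong pr₂ (subst-shift-cancel c M N)
  subst-shift-cancel c (coe σ M)  N = cong (coe σ) (subst-shift-cancel c M N)

  shift-subst-comm : ∀ {c j} → c ≤ j → (M N : Tm T) →
                     subst (suc j) (shift c M) (shift c N) ≡ shift c (subst j M N)
  shift-subst-comm c≤j (u M) N = cong u (shift-subst-comm c≤j M N)
  shift-subst-comm {c} {j} c≤j (var i) N with <-≤-connex i c
  ... | inj₁ i<c rewrite shift-var-< i<c | subst-var-< (m<n⇒m<1+n (<-≤-trans i<c c≤j)) (shift c N)
                       | subst-var-< (<-≤-trans i<c c≤j) N | shift-var-< i<c = refl
  ... | inj₂ c≤i with <-cmp i j
  ...   | tri< i<j _ _ rewrite shift-var-≥ c≤i | subst-var-< (s≤s i<j) (shift c N)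
                             | subst-var-< i<j N | shift-var-≥ c≤i = refl
  ...   | tri≈ _ refl _ rewrite shift-var-≥ c≤i | subst-var-≡ (suc j) (shift c N)
                              | subst-var-≡ j N = refl
  ...   | tri> _ _ (s≤s {n = i'} j≤i') rewrite shift-var-≥ c≤i | subst-var-suc (s≤s j≤i') (shift c N)
                                             | subst-var-suc j≤i' N | shift-var-≥ (≤-trans c≤j j≤i') = refl
  shift-subst-comm {c} {j} c≤j (lam σ M) N = cong (lam σ) (begin
    subst (suc (suc j)) (shift (suc c) M) (shift 0 (shift c N))
      ≡⟨ cong (subst (suc (suc j)) (shift (suc c) M)) (shift-comm z≤n N) ⟨
    subst (suc (suc j)) (shift (suc c) M) (shift (suc c) (shift 0 N))
      ≡⟨ shift-subst-comm (s≤s c≤j) M (shift 0 N) ⟩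
    shift (suc c) (subst (suc j) M (shift 0 N)) ∎)
    where open Eq.≡-Reasoning
  shift-subst-comm c≤j (app M M') N  = cong₂ app (shift-subst-comm c≤j M N) (shift-subst-comm c≤j M' N)
  shift-subst-comm c≤j (pair M M') N = cong₂ pair (shift-subst-comm c≤j M N) (shift-subst-comm c≤j M' N)
  shift-subst-comm c≤j (pr₁ M) N     = cong pr₁ (shift-subst-comm c≤j M N)
  shift-subst-comm c≤j (pr₂ M) N     = cong pr₂ (shift-subst-comm c≤j M N)
  shift-subst-comm c≤j (coe σ M) N   = cong (coe σ) (shift-subst-comm c≤j M N)

  subst-subst : ∀ k j (A B N : Tm T) →
                subst (k + j) (subst k A B) N ≡ subst k (subst (suc (k + j)) A (shift k N)) (subst (k + j) B N)
  subst-subst k j (u A) B N = cong u (subst-subst k j A B N)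
  subst-subst k j (var i) B N with <-cmp i k
  ... | tri< i<k _ _ rewrite subst-var-< i<k B | subst-var-< (<-≤-trans i<k (m≤m+n k j)) N
                           | subst-var-< (m<n⇒m<1+n (<-≤-trans i<k (m≤m+n k j))) (shift k N)
                           | subst-var-< i<k (subst (k + j) B N) = refl
  ... | tri≈ _ refl _ rewrite subst-var-≡ k B | subst-var-< (s≤s (m≤m+n k j)) (shift k N)
                            | subst-var-≡ k (subst (k + j) B N) = refl
  ... | tri> _ _ (s≤s {n = i'} k≤i') with <-cmp i' (k + j)
  ...   | tri< i'<k+j _ _ rewrite subst-var-suc k≤i' B | subst-var-< i'<k+j N
                                | subst-var-< (s≤s i'<k+j) (shift k N)
                                | subst-var-suc k≤i' (subst (k + j) B N) = refl
  ...   | tri≈ _ refl _ rewrite subst-var-suc k≤i' B | subst-var-≡ (k + j) N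
                              | subst-var-≡ (suc (k + j)) (shift k N)
                              | subst-shift-cancel k N (subst (k + j) B N) = refl
  ...   | tri> _ _ (s≤s {n = i''} k+j≤i'') rewrite subst-var-suc k≤i' B | subst-var-suc k+j≤i'' N
                                             | subst-var-suc (s≤s k+j≤i'') (shift k N)
                                             | subst-var-suc (≤-trans (m≤m+n k j) k+j≤i'') (subst (k + j) B N) = refl
  subst-subst k j (lam σ A) B N = cong (lam σ) (begin
    subst (suc (k + j)) (subst (suc k) A (shift 0 B)) (shift 0 N)
      ≡⟨ subst-subst (suc k) j A (shift 0 B) (shift 0 N) ⟩
    subst (suc k) (subst (suc (suc (k + j))) A (shift (suc k) (shift 0 N))) (subst (suc (k + j)) (shift 0 B) (shift 0 N))
      ≡⟨ cong₂ (λ N' B' → subst (suc k) (subst (suc (suc (k + j))) A N') B')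
               (shift-comm z≤n N) (shift-subst-comm z≤n B N) ⟩
    subst (suc k) (subst (suc (suc (k + j))) A (shift 0 (shift k N))) (shift 0 (subst (k + j) B N)) ∎)
    where open Eq.≡-Reasoning
  subst-subst k j (app A A') B N  = cong₂ app (subst-subst k j A B N) (subst-subst k j A' B N)
  subst-subst k j (pair A A') B N = cong₂ pair (subst-subst k j A B N) (subst-subst k j A' B N)
  subst-subst k j (pr₁ A) B N     = cong pr₁ (subst-subst k j A B N)
  subst-subst k j (pr₂ A) B N     = cong pr₂ (subst-subst k j A B N)
  subst-subst k j (coe σ A) B N   = cong (coe σ) (subst-subst k j A B N)

  subst-⟶ : ∀ {j} {M M' : Tm T} (N : Tm T) → M ⟶ M' → subst j M N ⟶ subst j M' N
  subst-⟶ {j} N (β {σ} {A} {B}) =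
    Eq.subst (app (lam σ (subst (suc j) A (shift 0 N))) (subst j B N) ⟶_) (sym (subst-subst 0 j A B N)) β
  subst-⟶ N pr₁β      = pr₁β
  subst-⟶ N pr₂β      = pr₂β
  subst-⟶ N (ξlam s)  = ξlam (subst-⟶ _ s)
  subst-⟶ N (appL s)  = appL (subst-⟶ N s)
  subst-⟶ N (appR s)  = appR (subst-⟶ N s)
  subst-⟶ N (pairL s) = pairL (subst-⟶ N s)
  subst-⟶ N (pairR s) = pairR (subst-⟶ N s)
  subst-⟶ N (ξpr₁ s)  = ξpr₁ (subst-⟶ N s)
  subst-⟶ N (ξpr₂ s)  = ξpr₂ (subst-⟶ N s)
  subst-⟶ N (ξcoe s)  = ξcoe (subst-⟶ N s)

  SN-reflect : (f : Tm T → Tm T) → (∀ {M M'} → M ⟶ M' → f M ⟶ f M') → ∀ {M} → SN (f M) → SN M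
  SN-reflect f f-⟶ (acc rs) = acc λ s → SN-reflect f f-⟶ (rs (f-⟶ s))

  Sub : Set
  Sub = ℕ → Tm T

  exts : Sub → Sub
  exts γ zero    = var 0
  exts γ (suc i) = shift 0 (γ i)

  exts^ : ℕ → Sub → Sub
  exts^ zero    γ = γ
  exts^ (suc j) γ = exts (exts^ j γ)

  shift^ : ℕ → Tm T → Tm T
  shift^ zero    N = N
  shift^ (suc j) N = shift 0 (shift^ j N)

  _•_ : Tm T → Sub → Sub
  (N • γ) zero    = N
  (N • γ) (suc i) = γ i

  sub : Sub → Tm T → Tm T
  sub γ (u Δ)        = u (sub γ Δ)
  sub γ (var i)      = γ i
  sub γ (lam σ Δ)    = lam σ (sub (exts γ) Δ)
  sub γ (app Δ Δ')   = app (sub γ Δ) (sub γ Δ')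
  sub γ (pair Δ Δ')  = pair (sub γ Δ) (sub γ Δ')
  sub γ (pr₁ Δ)      = pr₁ (sub γ Δ)
  sub γ (pr₂ Δ)      = pr₂ (sub γ Δ)
  sub γ (coe σ Δ)    = coe σ (sub γ Δ)

  sub-id : ∀ {γ} → (∀ i → γ i ≡ var i) → (Δ : Tm T) → sub γ Δ ≡ Δ
  sub-id γ≗var (u Δ)       = cong u (sub-id γ≗var Δ)
  sub-id γ≗var (var i)     = γ≗var i
  sub-id γ≗var (lam σ Δ)   = cong (lam σ) (sub-id exts-γ≗var Δ)
    where
    exts-γ≗var : ∀ i → exts _ i ≡ var i
    exts-γ≗var zero    = refl
    exts-γ≗var (suc i) = cong (shift 0) (γ≗var i)
  sub-id γ≗var (app Δ Δ')  = cong₂ app (sub-id γ≗var Δ) (sub-id γ≗var Δ')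
  sub-id γ≗var (pair Δ Δ') = cong₂ pair (sub-id γ≗var Δ) (sub-id γ≗var Δ')
  sub-id γ≗var (pr₁ Δ)     = cong pr₁ (sub-id γ≗var Δ)
  sub-id γ≗var (pr₂ Δ)     = cong pr₂ (sub-id γ≗var Δ)
  sub-id γ≗var (coe σ Δ)   = cong (coe σ) (sub-id γ≗var Δ)

  subst-exts^-var : ∀ j i γ N → subst j (exts^ (suc j) γ i) (shift^ j N) ≡ exts^ j (N • γ) i
  subst-exts^-var zero    zero    γ N = subst-var-≡ 0 N
  subst-exts^-var zero    (suc i) γ N = subst-shift-cancel 0 (γ i) N
  subst-exts^-var (suc j) zero    γ N = refl
  subst-exts^-var (suc j) (suc i) γ N =
    Eq.trans (shift-subst-comm z≤n (exts^ (suc j) γ i) (shift^ j N)) (cong (shift 0) (subst-exts^-var j i γ N))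

  subst-exts^-sub : ∀ j γ N (Δ : Tm T) →
                    subst j (sub (exts^ (suc j) γ) Δ) (shift^ j N) ≡ sub (exts^ j (N • γ)) Δ
  subst-exts^-sub j γ N (u Δ)       = cong u (subst-exts^-sub j γ N Δ)
  subst-exts^-sub j γ N (var i)     = subst-exts^-var j i γ N
  subst-exts^-sub j γ N (lam σ Δ)   = cong (lam σ) (subst-exts^-sub (suc j) γ N Δ)
  subst-exts^-sub j γ N (app Δ Δ')  = cong₂ app (subst-exts^-sub j γ N Δ) (subst-exts^-sub j γ N Δ')
  subst-exts^-sub j γ N (pair Δ Δ') = cong₂ pair (subst-exts^-sub j γ N Δ) (subst-exts^-sub j γ N Δ')
  subst-exts^-sub j γ N (pr₁ Δ)     = cong pr₁ (subst-exts^-sub j γ N Δ)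
  subst-exts^-sub j γ N (pr₂ Δ)     = cong pr₂ (subst-exts^-sub j γ N Δ)
  subst-exts^-sub j γ N (coe σ Δ)   = cong (coe σ) (subst-exts^-sub j γ N Δ)

  data Neutral : Tm T → Set where
    u   : ∀ {Δ} → Neutral (u Δ)
    var : ∀ {i} → Neutral (var i)
    app : ∀ {M N} → Neutral (app M N)
    pr₁ : ∀ {M} → Neutral (pr₁ M)
    pr₂ : ∀ {M} → Neutral (pr₂ M)
    coe : ∀ {σ M} → Neutral (coe σ M)

  Reducible : Ty T → Tm T → Set
  Reducible (at _)  M = SN M
  Reducible (ω _)   M = SN M
  Reducible (σ ⇒ τ) M = ∀ N → Reducible σ N → Reducible τ (app M N)
  Reducible (σ ∩ τ) M = Reducible σ (pr₁ M) × Reducible τ (pr₂ M)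

  reducible-⟶ : ∀ σ {M M'} → Reducible σ M → M ⟶ M' → Reducible σ M'
  reducible-⟶ (at _)  (acc rs) s = rs s
  reducible-⟶ (ω _)   (acc rs) s = rs s
  reducible-⟶ (σ ⇒ τ) r        s = λ N rN → reducible-⟶ τ (r N rN) (appL s)
  reducible-⟶ (σ ∩ τ) (r₁ , r₂) s = reducible-⟶ σ r₁ (ξpr₁ s) , reducible-⟶ τ r₂ (ξpr₂ s)

  mutual
    reducible⇒SN : ∀ σ {M} → Reducible σ M → SN M
    reducible⇒SN (at _)  r       = r
    reducible⇒SN (ω _)   r       = r
    reducible⇒SN (σ ⇒ τ) r       = SN-reflect (λ M → app M (var 0)) appL
                                     (reducible⇒SN τ (r (var 0) (var-reducible σ)))
    reducible⇒SN (σ ∩ τ) (r₁ , _) = SN-reflect pr₁ ξpr₁ (reducible⇒SN σ r₁)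

    neutral-reducible : ∀ σ {M} → Neutral M → (∀ {M'} → M ⟶ M' → Reducible σ M') → Reducible σ M
    neutral-reducible (at _)  _  h = acc h
    neutral-reducible (ω _)   _  h = acc h
    neutral-reducible (σ ⇒ τ) {M} ne h N rN = go (reducible⇒SN σ rN) rN
      where
      go : ∀ {N} → SN N → Reducible σ N → Reducible τ (app M N)
      go {N} (acc rs) rN = neutral-reducible τ app (reduct ne)
        where
        reduct : Neutral M → ∀ {X} → app M N ⟶ X → Reducible τ X
        reduct () β
        reduct _  (appL s) = h s N rN
        reduct _  (appR s) = go (rs s) (reducible-⟶ σ rN s)
    neutral-reducible (σ ∩ τ) {M} ne h = neutral-reducible σ pr₁ (reduct₁ ne) , neutral-reducible τ pr₂ (reduct₂ ne)
      where
      reduct₁ : Neutral M → ∀ {X} → pr₁ M ⟶ X → Reducible σ X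
      reduct₁ () pr₁β
      reduct₁ _  (ξpr₁ s) = proj₁ (h s)
      reduct₂ : Neutral M → ∀ {X} → pr₂ M ⟶ X → Reducible τ X
      reduct₂ () pr₂β
      reduct₂ _  (ξpr₂ s) = proj₂ (h s)

    var-reducible : ∀ σ {i} → Reducible σ (var i)
    var-reducible σ = neutral-reducible σ var (λ ())

  lam-reducible : ∀ {ρ σ τ} (D : Tm T) → (∀ N → Reducible σ N → Reducible τ (subst 0 D N)) →
                  Reducible (σ ⇒ τ) (lam ρ D)
  lam-reducible {ρ} {σ} {τ} D h N rN = go SN-D h (reducible⇒SN σ rN) rN
    where
    SN-D : SN D
    SN-D = SN-reflect (λ M → subst 0 M (var 0)) (subst-⟶ (var 0)) (reducible⇒SN τ (h (var 0) (var-reducible σ)))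

    go : ∀ {D N} → SN D → (∀ N → Reducible σ N → Reducible τ (subst 0 D N)) →
         SN N → Reducible σ N → Reducible τ (app (lam ρ D) N)
    go {N = N} (acc rsD) h (acc rsN) rN = neutral-reducible τ app λ where
      β               → h N rN
      (appL (ξlam s)) → go (rsD s) (λ N' rN' → reducible-⟶ τ (h N' rN') (subst-⟶ N' s)) (acc rsN) rN
      (appR s)        → go (acc rsD) h (rsN s) (reducible-⟶ σ rN s)

  pair-reducible : ∀ {σ τ} {A B : Tm T} → Reducible σ A → Reducible τ B → Reducible (σ ∩ τ) (pair A B)
  pair-reducible {σ} {τ} rA rB =
    go₁ (reducible⇒SN σ rA) (reducible⇒SN τ rB) rA , go₂ (reducible⇒SN σ rA) (reducible⇒SN τ rB) rB
    where
    go₁ : ∀ {A B} → SN A → SN B → Reducible σ A → Reducible σ (pr₁ (pair A B))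
    go₁ (acc rsA) (acc rsB) rA = neutral-reducible σ pr₁ λ where
      pr₁β              → rA
      (ξpr₁ (pairL s)) → go₁ (rsA s) (acc rsB) (reducible-⟶ σ rA s)
      (ξpr₁ (pairR s)) → go₁ (acc rsA) (rsB s) rA
    go₂ : ∀ {A B} → SN A → SN B → Reducible τ B → Reducible τ (pr₂ (pair A B))
    go₂ (acc rsA) (acc rsB) rB = neutral-reducible τ pr₂ λ where
      pr₂β              → rB
      (ξpr₂ (pairL s)) → go₂ (rsA s) (acc rsB) rB
      (ξpr₂ (pairR s)) → go₂ (acc rsA) (rsB s) (reducible-⟶ τ rB s)

  coe-reducible : ∀ τ {M : Tm T} → SN M → Reducible τ (coe τ M)
  coe-reducible τ (acc rs) = neutral-reducible τ coe λ where (ξcoe s) → coe-reducible τ (rs s)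

  fundamental : ∀ {R B Δ σ} → T , R ∣ B ⊢ Δ ⦂ σ →
                (γ : Sub) → (∀ {i τ} → B ∋ i ⦂ τ → Reducible τ (γ i)) → Reducible σ (sub γ Δ)
  fundamental (top o)    γ γ-red = acc λ ()
  fundamental (ax x)     γ γ-red = γ-red x
  fundamental {B = B} {Δ = lam σ Δ} (→I ⊢Δ) γ γ-red = lam-reducible (sub (exts γ) Δ) λ N rN →
    Eq.subst (Reducible _) (sym (subst-exts^-sub 0 γ N Δ)) (fundamental ⊢Δ (N • γ) (•-red rN))
    where
    •-red : ∀ {N} → Reducible σ N → ∀ {i τ} → (σ ∷ B) ∋ i ⦂ τ → Reducible τ ((N • γ) i)
    •-red rN here      = rN
    •-red rN (there x) = γ-red x
  fundamental (→E ⊢M ⊢N)   γ γ-red = fundamental ⊢M γ γ-red _ (fundamental ⊢N γ γ-red)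
  fundamental (∩I ⊢A ⊢B _) γ γ-red = pair-reducible (fundamental ⊢A γ γ-red) (fundamental ⊢B γ γ-red)
  fundamental (∩E₁ ⊢M)     γ γ-red = proj₁ (fundamental ⊢M γ γ-red)
  fundamental (∩E₂ ⊢M)     γ γ-red = proj₂ (fundamental ⊢M γ γ-red)
  fundamental (≤T {σ = σ} ⊢M _) γ γ-red = coe-reducible _ (reducible⇒SN σ (fundamental ⊢M γ γ-red))

theorem4p9 : (T : Theory) (R : Rel) {B : List (Ty T)} {Δ : Tm T} {σ : Ty T} →
             T , R ∣ B ⊢ Δ ⦂ σ → SN Δ
theorem4p9 T R {Δ = Δ} {σ} ⊢Δ =
  Eq.subst SN (sub-id (λ _ → refl) Δ) (reducible⇒SN σ (fundamental ⊢Δ var (λ _ → var-reducible _)))
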